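{- Let $G$ be a graph with a chordless spanning linkage $L$ of order $2$. Then $L$ is vital if and only if $G$ has no $\mathit{XX}$ linkage minor with respect to $L$.
   Context: A linkage in a graph $G$ is a subgraph each of whose components is a path; its order is the number of components. A linkage $L$ of order $k$ is unique if no other collection of $k$ vertex-disjoint paths connects the same pairs of end vertices (terminals), spanning if $V(L)=V(G)$, and vital if it is both unique and spanning. Given a spanning linkage $L$ of $G$, edges of $L$ are path edges; an edge of $E(G)\setminus E(L)$ is a chord if both endpoints lie in the same component of $L$, and a rung edge otherwise; $L$ is chordless if there are no chords. A linkage minor of $G$ with respect to a chordless linkage $L$ is a minor $H$ of $G$ such that every path edge in $E(G)\setminus E(H)$ has been contracted and every rung edge in $E(G)\setminus E(H)$ has been deleted. For $L$ of order 2, $G$ has an $\mathit{XX}$ linkage minor with respect to $L$ if $G$ has a linkage minor isomorphic to $K_{2,4}$ in which the four terminal vertices of $L$ are mapped to the four degree-2 vertices of $K_{2,4}$. -}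

module Defs where

open import Data.Nat using (ℕ)
open import Data.Fin using (Fin)
import Data.Fin as Fin
open import Data.List using (List; []; _∷_; _++_; head; last)
open import Data.List.Relation.Unary.Linked using (Linked)
open import Data.List.Relation.Unary.All using (All)
open import Data.List.Relation.Unary.Unique.Propositional using (Unique)
open import Data.List.Membership.Propositional using (_∈_)
open import Data.Maybe using (just)
open import Data.Product using (Σ; _×_; ∃; ∃-syntax)
open import Data.Sum using (_⊎_; inj₁; inj₂)
open import Data.Empty using (⊥)
open import Data.Unit using (⊤)
open import Relation.Nullary using (¬_)
open import Relation.Binary.PropositionalEquality using (_≡_)
open import Function.Bundles using (_⇔_)

record Graph (n : ℕ) : Set₁ where
  field
    Adj    : Fin n → Fin n → Set
    sym    : ∀ {u v} → Adj u v → Adj v u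
    irrefl : ∀ {v} → ¬ Adj v v
open Graph public

-- Paths.  A path with end vertices s and t is represented by the list of
-- its vertices in order from s to t (for fixed orientation s → t this
-- representation of the path subgraph is unique).

IsPath : ∀ {n} → Graph n → Fin n → Fin n → List (Fin n) → Set
IsPath G s t p =
  Linked (Adj G) p × Unique p × head p ≡ just s × last p ≡ just t

Disjoint : ∀ {n} → List (Fin n) → List (Fin n) → Set
Disjoint p q = ∀ v → v ∈ p → v ∈ q → ⊥

Consec : ∀ {n} → List (Fin n) → Fin n → Fin n → Set
Consec p u v = ∃[ xs ] ∃[ ys ] p ≡ xs ++ (u ∷ v ∷ ys)

EdgeOf : ∀ {n} → List (Fin n) → Fin n → Fin n → Set
EdgeOf p u v = Consec p u v ⊎ Consec p v u

record Linkage2 {n : ℕ} (G : Graph n) : Set where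
  field
    s₁ t₁ s₂ t₂ : Fin n
    P₁ P₂       : List (Fin n)
    isPath₁     : IsPath G s₁ t₁ P₁
    isPath₂     : IsPath G s₂ t₂ P₂
    disjoint    : Disjoint P₁ P₂
open Linkage2 public

module _ {n : ℕ} {G : Graph n} (L : Linkage2 G) where

  UniqueLinkage : Set
  UniqueLinkage =
    ∀ (Q₁ Q₂ : List (Fin n)) →
    IsPath G (s₁ L) (t₁ L) Q₁ → IsPath G (s₂ L) (t₂ L) Q₂ →
    Disjoint Q₁ Q₂ → (Q₁ ≡ P₁ L) × (Q₂ ≡ P₂ L)

  Spanning : Set
  Spanning = ∀ v → v ∈ P₁ L ⊎ v ∈ P₂ L

  Vital : Set
  Vital = UniqueLinkage × Spanning

  PathEdge : Fin n → Fin n → Set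
  PathEdge u v = EdgeOf (P₁ L) u v ⊎ EdgeOf (P₂ L) u v

  SameComponent : Fin n → Fin n → Set
  SameComponent u v = (u ∈ P₁ L × v ∈ P₁ L) ⊎ (u ∈ P₂ L × v ∈ P₂ L)

  Chord : Fin n → Fin n → Set
  Chord u v = Adj G u v × ¬ PathEdge u v × SameComponent u v

  Chordless : Set
  Chordless = ∀ u v → ¬ Chord u v

  -- Linkage minors isomorphic to K_{2,4}, described by their branch
  -- sets.  Vertices of K_{2,4}: inj₁ i (degree 4, i : Fin 2) and
  -- inj₂ j (degree 2, j : Fin 4).  Since only path edges may be
  -- contracted and only rung edges deleted (no vertex deletions), a
  -- linkage minor is given by a map β : V(G) → V(H) whose fibres (branch
  -- sets) are non-empty and connected by path edges; each edge of H
  -- comes from a kept edge of G between the branch sets, and every path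
  -- edge between distinct branch sets is kept (so must be an edge of H),
  -- while rung edges between branch sets non-adjacent in H are deleted.

  K24 : Set
  K24 = Fin 2 ⊎ Fin 4

  K24Adj : K24 → K24 → Set
  K24Adj (inj₁ _) (inj₁ _) = ⊥
  K24Adj (inj₁ _) (inj₂ _) = ⊤
  K24Adj (inj₂ _) (inj₁ _) = ⊤
  K24Adj (inj₂ _) (inj₂ _) = ⊥

  terminal : Fin 4 → Fin n
  terminal Fin.zero = s₁ L
  terminal (Fin.suc Fin.zero) = t₁ L
  terminal (Fin.suc (Fin.suc Fin.zero)) = s₂ L
  terminal (Fin.suc (Fin.suc (Fin.suc Fin.zero))) = t₂ L

  record XXModel : Set where
    field
      β          : Fin n → K24
      nonempty   : ∀ x → ∃[ v ] β v ≡ x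
      connected  : ∀ u v → β u ≡ β v →
                   ∃[ w ] (Linked PathEdge w × head w ≡ just u ×
                           last w ≡ just v × All (λ z → β z ≡ β u) w)
      edges      : ∀ x y → K24Adj x y →
                   ∃[ u ] ∃[ v ] (β u ≡ x × β v ≡ y × Adj G u v)
      -- path edges are never deleted: a path edge between distinct branch
      -- sets yields an edge of K_{2,4}
      pathKept   : ∀ u v → PathEdge u v → ¬ (β u ≡ β v) → K24Adj (β u) (β v)
      termDeg2   : ∀ i → ∃[ j ] β (terminal i) ≡ inj₂ j
      termInj    : ∀ i j → β (terminal i) ≡ β (terminal j) → i ≡ j

  HasXXMinor : Set
  HasXXMinor = XXModel

module Submission where

-- Chordlessness makes each Pᵢ an induced path.  Indexing Pᵢ by positions,
-- every edge inside Pᵢ changes the position by one, so walks inside Pᵢ are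
-- unit-step walks of positions: they visit all intermediate positions, and
-- the only path between the ends of Pᵢ inside Pᵢ is Pᵢ itself.
--
-- (⇐) A second linkage Q₁, Q₂ must leave both P₁ and P₂.  Then Qᵢ covers Pᵢ
-- up to where it departs and from where it returns, and the other path meets
-- Pᵢ only in between; these three intervals on each Pᵢ are the branch sets
-- of an XX minor.
-- (⇒) Conversely the branch sets of an XX minor are intervals of P₁ or P₂;
-- its K_{2,4}-edges give four rungs in crossing order, along which one can
-- reroute L into a second linkage, so L is not unique.

open import Defs hiding (sym)
open import Data.Nat using (ℕ; zero; suc; pred; _+_; _∸_; _≤_; _<_; z≤n; s≤s; _≤?_; _≟_)
open import Data.Nat.Properties
open import Data.Fin using (Fin)
import Data.Fin as Fin
open import Data.List using (List; []; _∷_; _++_; head; last; map; length)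
open import Data.List.Properties using (++-assoc)
open import Data.List.Relation.Unary.Linked as Linked using (Linked; []; [-]; _∷_)
open import Data.List.Relation.Unary.All as All using (All; []; _∷_)
open import Data.List.Relation.Unary.AllPairs using ([]; _∷_)
open import Data.List.Relation.Unary.Any using (here; there)
open import Data.List.Relation.Unary.Unique.Propositional using (Unique)
open import Data.List.Membership.Propositional using (_∈_; _∉_)
open import Data.List.Membership.Propositional.Properties using (∈-map⁻; ∈-++⁻; ∈-++⁺ˡ; ∈-++⁺ʳ)
open import Data.Maybe using (just)
open import Data.Maybe.Properties using (just-injective)
open import Data.Maybe.Relation.Binary.Connected using (Connected; just)
import Data.List.Relation.Unary.Linked.Properties as LinkedProps
import Data.List.Relation.Unary.Unique.Propositional.Properties as Unique
open import Data.Product using (_×_; _,_; ∃-syntax; proj₁; proj₂)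
open import Data.Sum using (_⊎_; inj₁; inj₂; swap)
open import Data.Sum.Properties using (inj₂-injective; ≡-dec)
open import Data.Unit using (tt)
open import Data.Empty using (⊥; ⊥-elim)
open import Relation.Nullary using (¬_; yes; no; Dec)
open import Relation.Nullary.Decidable using (_⊎-dec_)
open import Relation.Unary using (Decidable)
open import Relation.Binary.Definitions using (DecidableEquality)
open import Relation.Binary.PropositionalEquality
open import Function using (_∘_)
open import Function.Bundles using (_⇔_; mk⇔)

-- Walks of natural numbers in unit steps.  Positions along an induced path
-- move by exactly one along every edge, so these are the coordinate shadows
-- of walks inside a path.

module UnitWalks where

  Step : ℕ → ℕ → Set
  Step a b = b ≡ suc a ⊎ a ≡ suc b

  Between : ℕ → ℕ → ℕ → Set
  Between s e h = (s ≤ h × h ≤ e) ⊎ (e ≤ h × h ≤ s)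

  visits-between : ∀ {s e h} (ns : List ℕ) → Linked Step ns →
                   head ns ≡ just s → last ns ≡ just e → Between s e h → h ∈ ns
  visits-between (x ∷ []) _ refl refl (inj₁ (x≤h , h≤x)) = here (≤-antisym h≤x x≤h)
  visits-between (x ∷ []) _ refl refl (inj₂ (x≤h , h≤x)) = here (≤-antisym h≤x x≤h)
  visits-between {e = e} {h} (x ∷ y ∷ ns) (st ∷ l) refl le bt with h ≟ x
  ... | yes h≡x = here h≡x
  ... | no h≢x = there (visits-between (y ∷ ns) l refl le (narrow st bt))
    where
    narrow : Step x y → Between x e h → Between y e h
    narrow (inj₁ refl) (inj₁ (x≤h , h≤e)) = inj₁ (≤∧≢⇒< x≤h (h≢x ∘ sym) , h≤e)
    narrow (inj₁ refl) (inj₂ (e≤h , h≤x)) = inj₂ (e≤h , m≤n⇒m≤1+n h≤x)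
    narrow (inj₂ refl) (inj₁ (x≤h , h≤e)) = inj₁ (m+n≤o⇒n≤o 1 x≤h , h≤e)
    narrow (inj₂ refl) (inj₂ (e≤h , h≤x)) = inj₂ (e≤h , ≤-pred (≤∧≢⇒< h≤x h≢x))

  step? : ∀ a b → Dec (Step a b)
  step? a b = (b ≟ suc a) ⊎-dec (a ≟ suc b)

  first-change : ∀ {Q : ℕ → Set} → (∀ h → Dec (Q h)) → ∀ N → Q 0 → ¬ Q N →
                 ∃[ h ] (h < N × Q h × ¬ Q (suc h))
  first-change Q? zero q0 ¬qN = ⊥-elim (¬qN q0)
  first-change Q? (suc k) q0 ¬qN with Q? k
  ... | yes qk = k , ≤-refl , qk , ¬qN
  ... | no ¬qk with first-change Q? k q0 ¬qk
  ...   | h , h<k , qh , ¬qh+1 = h , m<n⇒m<1+n h<k , qh , ¬qh+1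

  between-≤ : ∀ {i j h m} → i ≤ m → j ≤ m → Between i j h → h ≤ m
  between-≤ _ j≤m (inj₁ (_ , h≤j)) = ≤-trans h≤j j≤m
  between-≤ i≤m _ (inj₂ (_ , h≤i)) = ≤-trans h≤i i≤m

  between-< : ∀ {i j h m} → i < m → j < m → Between i j h → h < m
  between-< _ j<m (inj₁ (_ , h≤j)) = ≤-<-trans h≤j j<m
  between-< i<m _ (inj₂ (_ , h≤i)) = ≤-<-trans h≤i i<m

  between-≥ : ∀ {i j h m} → m ≤ i → m ≤ j → Between i j h → m ≤ h
  between-≥ m≤i _ (inj₁ (i≤h , _)) = ≤-trans m≤i i≤h
  between-≥ _ m≤j (inj₂ (j≤h , _)) = ≤-trans m≤j j≤h

  ascending : ℕ → ℕ → List ℕ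
  ascending i zero = i ∷ []
  ascending i (suc k) = i ∷ ascending (suc i) k

  ascending-head : ∀ i k → head (ascending i k) ≡ just i
  ascending-head i zero = refl
  ascending-head i (suc k) = refl

  ascending-last : ∀ i k → last (ascending i k) ≡ just (i + k)
  ascending-last i zero = cong just (sym (+-identityʳ i))
  ascending-last i (suc zero) = cong just (sym (+-comm i 1))
  ascending-last i (suc (suc k)) =
    trans (ascending-last (suc i) (suc k)) (cong just (sym (+-suc i (suc k))))

  ascending-steps : ∀ i k → Linked Step (ascending i k)
  ascending-steps i zero = [-]
  ascending-steps i (suc zero) = inj₁ refl ∷ [-]
  ascending-steps i (suc (suc k)) = inj₁ refl ∷ ascending-steps (suc i) (suc k)

  ascending-range : ∀ {h} i k → h ∈ ascending i k → i ≤ h × h ≤ i + k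
  ascending-range i zero (here refl) = ≤-refl , m≤m+n i 0
  ascending-range i (suc k) (here refl) = ≤-refl , m≤m+n i (suc k)
  ascending-range {h} i (suc k) (there p) with ascending-range (suc i) k p
  ... | i<h , h≤ = <⇒≤ i<h , subst (h ≤_) (sym (+-suc i k)) h≤

  ascending-unique : ∀ i k → Unique (ascending i k)
  ascending-unique i zero = [] ∷ []
  ascending-unique i (suc k) =
    All.tabulate (λ p i≡ → <-irrefl i≡ (proj₁ (ascending-range (suc i) k p)))
    ∷ ascending-unique (suc i) k

  descending : ℕ → ℕ → List ℕ
  descending j zero = j ∷ []
  descending j (suc k) = (j + suc k) ∷ descending j k

  descending-head : ∀ j k → head (descending j k) ≡ just (j + k)
  descending-head j zero = cong just (sym (+-identityʳ j))
  descending-head j (suc k) = refl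

  descending-last : ∀ j k → last (descending j k) ≡ just j
  descending-last j zero = refl
  descending-last j (suc zero) = refl
  descending-last j (suc (suc k)) = descending-last j (suc k)

  descending-steps : ∀ j k → Linked Step (descending j k)
  descending-steps j zero = [-]
  descending-steps j (suc zero) = inj₂ (+-comm j 1) ∷ [-]
  descending-steps j (suc (suc k)) = inj₂ (+-suc j (suc k)) ∷ descending-steps j (suc k)

  descending-range : ∀ {h} j k → h ∈ descending j k → j ≤ h × h ≤ j + k
  descending-range j zero (here refl) = ≤-refl , m≤m+n j 0
  descending-range j (suc k) (here refl) = m≤m+n j (suc k) , ≤-refl
  descending-range j (suc k) (there p) with descending-range j k p
  ... | j≤h , h≤ = j≤h , ≤-trans h≤ (+-monoʳ-≤ j (n≤1+n k))

  descending-unique : ∀ j k → Unique (descending j k)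
  descending-unique j zero = [] ∷ []
  descending-unique j (suc k) =
    All.tabulate (λ {x} p eq → <-irrefl (sym eq)
                   (subst (x <_) (sym (+-suc j k)) (s≤s (proj₂ (descending-range j k p)))))
    ∷ descending-unique j k

  segment : ℕ → ℕ → List ℕ
  segment i j with i ≤? j
  ... | yes _ = ascending i (j ∸ i)
  ... | no _ = descending j (i ∸ j)

  segment-head : ∀ i j → head (segment i j) ≡ just i
  segment-head i j with i ≤? j
  ... | yes _ = ascending-head i (j ∸ i)
  ... | no i≰j = trans (descending-head j (i ∸ j)) (cong just (m+[n∸m]≡n (<⇒≤ (≰⇒> i≰j))))

  segment-last : ∀ i j → last (segment i j) ≡ just j
  segment-last i j with i ≤? j
  ... | yes i≤j = trans (ascending-last i (j ∸ i)) (cong just (m+[n∸m]≡n i≤j))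
  ... | no _ = descending-last j (i ∸ j)

  segment-steps : ∀ i j → Linked Step (segment i j)
  segment-steps i j with i ≤? j
  ... | yes _ = ascending-steps i (j ∸ i)
  ... | no _ = descending-steps j (i ∸ j)

  segment-unique : ∀ i j → Unique (segment i j)
  segment-unique i j with i ≤? j
  ... | yes _ = ascending-unique i (j ∸ i)
  ... | no _ = descending-unique j (i ∸ j)

  segment-between : ∀ {h} i j → h ∈ segment i j → Between i j h
  segment-between {h} i j p with i ≤? j
  ... | yes i≤j = let (i≤h , h≤) = ascending-range i (j ∸ i) p
                  in inj₁ (i≤h , subst (h ≤_) (m+[n∸m]≡n i≤j) h≤)
  ... | no i≰j = let (j≤h , h≤) = descending-range j (i ∸ j) p
                 in inj₂ (j≤h , subst (h ≤_) (m+[n∸m]≡n (<⇒≤ (≰⇒> i≰j))) h≤)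

  -- a repetition-free unit-step walk that starts at 0 is the ascending run
  -- (it can never step down, as that would revisit its predecessor)
  ascending-walk : ∀ s rest → Linked Step (s ∷ rest) → Unique (s ∷ rest) →
                   (∀ t → s ≡ suc t → t ∉ rest) → s ∷ rest ≡ ascending s (length rest)
  ascending-walk s [] _ _ _ = refl
  ascending-walk s (r ∷ rest) (inj₁ refl ∷ l) (s∉ ∷ u) _ =
    cong (s ∷_) (ascending-walk (suc s) rest l u
      (λ t eq t∈ → All.lookup s∉ (there (subst (_∈ rest) (sym (suc-injective eq)) t∈)) refl))
  ascending-walk s (r ∷ rest) (inj₂ eq ∷ l) u no-pred = ⊥-elim (no-pred r eq (here refl))

open UnitWalks

-- Positions in a list of vertices: nth reads the entry at a position (with
-- a default value out of range) and idx finds the position of the first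
-- occurrence.

module Positions {n : ℕ} where

  private
    A = Fin n

  nth : List A → A → ℕ → A
  nth [] d _ = d
  nth (x ∷ xs) d zero = x
  nth (x ∷ xs) d (suc i) = nth xs d i

  idx : List A → A → ℕ
  idx [] v = 0
  idx (x ∷ xs) v with v Fin.≟ x
  ... | yes _ = 0
  ... | no _ = suc (idx xs v)

  idx-here : ∀ x xs → idx (x ∷ xs) x ≡ 0
  idx-here x xs with x Fin.≟ x
  ... | yes _ = refl
  ... | no x≢x = ⊥-elim (x≢x refl)

  idx-there : ∀ {v x} xs → v ≢ x → idx (x ∷ xs) v ≡ suc (idx xs v)
  idx-there {v} {x} xs v≢x with v Fin.≟ x
  ... | yes v≡x = ⊥-elim (v≢x v≡x)
  ... | no _ = refl

  nth-idx : ∀ {v} d (P : List A) → v ∈ P → nth P d (idx P v) ≡ v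
  nth-idx {v} d (x ∷ xs) v∈ with v Fin.≟ x | v∈
  ... | yes v≡x | _ = sym v≡x
  ... | no v≢x | here v≡x = ⊥-elim (v≢x v≡x)
  ... | no _ | there v∈xs = nth-idx d xs v∈xs

  idx-< : ∀ {v} (P : List A) → v ∈ P → idx P v < length P
  idx-< {v} (x ∷ xs) v∈ with v Fin.≟ x | v∈
  ... | yes _ | _ = s≤s z≤n
  ... | no v≢x | here v≡x = ⊥-elim (v≢x v≡x)
  ... | no _ | there v∈xs = s≤s (idx-< xs v∈xs)

  nth-∈ : ∀ d (P : List A) i → i < length P → nth P d i ∈ P
  nth-∈ d (x ∷ xs) zero _ = here refl
  nth-∈ d (x ∷ xs) (suc i) (s≤s i<) = there (nth-∈ d xs i i<)

  idx-nth : ∀ d (P : List A) i → Unique P → i < length P → idx P (nth P d i) ≡ i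
  idx-nth d (x ∷ xs) zero _ _ = idx-here x xs
  idx-nth d (x ∷ xs) (suc i) (x∉ ∷ u) (s≤s i<) =
    trans (idx-there xs (λ eq → All.lookup x∉ (nth-∈ d xs i i<) (sym eq)))
          (cong suc (idx-nth d xs i u i<))

  nth-head : ∀ d (P : List A) {s} → head P ≡ just s → nth P d 0 ≡ s
  nth-head d (x ∷ xs) refl = refl

  nth-last : ∀ d (P : List A) {t} → last P ≡ just t → nth P d (pred (length P)) ≡ t
  nth-last d (x ∷ []) refl = refl
  nth-last d (x ∷ y ∷ xs) eq = nth-last d (y ∷ xs) eq

  nth-linked : ∀ {R : A → A → Set} d (P : List A) → Linked R P →
               ∀ i → suc i < length P → R (nth P d i) (nth P d (suc i))
  nth-linked d (x ∷ []) [-] i (s≤s ())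
  nth-linked d (x ∷ y ∷ xs) (r ∷ l) zero _ = r
  nth-linked d (x ∷ y ∷ xs) (r ∷ l) (suc i) (s≤s i<) = nth-linked d (y ∷ xs) l i i<

  nth-consec : ∀ d (P : List A) i → suc i < length P → Consec P (nth P d i) (nth P d (suc i))
  nth-consec d (x ∷ []) i (s≤s ())
  nth-consec d (x ∷ y ∷ xs) zero _ = [] , xs , refl
  nth-consec d (x ∷ y ∷ xs) (suc i) (s≤s i<) with nth-consec d (y ∷ xs) i i<
  ... | as , bs , eq = x ∷ as , bs , cong (x ∷_) eq

  consec-idx : ∀ xs {u v ys} → Unique (xs ++ u ∷ v ∷ ys) →
               idx (xs ++ u ∷ v ∷ ys) v ≡ suc (idx (xs ++ u ∷ v ∷ ys) u)
  consec-idx [] {u} {v} {ys} (u∉ ∷ _) = begin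
    idx (u ∷ v ∷ ys) v    ≡⟨ idx-there (v ∷ ys) (λ v≡u → All.head u∉ (sym v≡u)) ⟩
    suc (idx (v ∷ ys) v)  ≡⟨ cong suc (idx-here v ys) ⟩
    1                     ≡⟨ cong suc (sym (idx-here u (v ∷ ys))) ⟩
    suc (idx (u ∷ v ∷ ys) u) ∎
    where open ≡-Reasoning
  consec-idx (x ∷ xs) {u} {v} {ys} (x∉ ∷ uniq) = begin
    idx (x ∷ rest) v        ≡⟨ idx-there rest (differs (there (here refl))) ⟩
    suc (idx rest v)        ≡⟨ cong suc (consec-idx xs uniq) ⟩
    suc (suc (idx rest u))  ≡⟨ cong suc (sym (idx-there rest (differs (here refl)))) ⟩
    suc (idx (x ∷ rest) u)  ∎
    where
    open ≡-Reasoning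
    rest = xs ++ u ∷ v ∷ ys
    differs : ∀ {w} → w ∈ u ∷ v ∷ ys → w ≢ x
    differs w∈ w≡x = All.lookup x∉ (∈-++⁺ʳ xs w∈) (sym w≡x)

  edge-step : ∀ {P : List A} {u v} → Unique P → EdgeOf P u v → Step (idx P u) (idx P v)
  edge-step uniq (inj₁ (xs , _ , refl)) = inj₁ (consec-idx xs uniq)
  edge-step uniq (inj₂ (xs , _ , refl)) = inj₂ (consec-idx xs uniq)

  step-edge : ∀ d (P : List A) {u v} → u ∈ P → v ∈ P → Step (idx P u) (idx P v) → EdgeOf P u v
  step-edge d P {u} {v} u∈ v∈ (inj₁ eq) =
    inj₁ (subst₂ (Consec P) (nth-idx d P u∈) (trans (cong (nth P d) (sym eq)) (nth-idx d P v∈))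
                 (nth-consec d P (idx P u) (subst (_< length P) eq (idx-< P v∈))))
  step-edge d P {u} {v} u∈ v∈ (inj₂ eq) =
    inj₂ (subst₂ (Consec P) (nth-idx d P v∈) (trans (cong (nth P d) (sym eq)) (nth-idx d P u∈))
                 (nth-consec d P (idx P v) (subst (_< length P) eq (idx-< P u∈))))

  list-as-positions : ∀ d (x : A) xs → x ∷ xs ≡ map (nth (x ∷ xs) d) (ascending 0 (pred (length (x ∷ xs))))
  list-as-positions d x [] = refl
  list-as-positions d x (y ∷ ys) =
    cong (x ∷_) (trans (list-as-positions d y ys) (sym (shift 0 (length ys))))
    where
    shift : ∀ j k → map (nth (x ∷ y ∷ ys) d) (ascending (suc j) k) ≡ map (nth (y ∷ ys) d) (ascending j k)
    shift j zero = refl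
    shift j (suc k) = cong (nth (y ∷ ys) d j ∷_) (shift (suc j) k)

module ListFacts {A : Set} where

  head-∈ : ∀ (xs : List A) {x} → head xs ≡ just x → x ∈ xs
  head-∈ (y ∷ ys) refl = here refl

  last-∈ : ∀ (xs : List A) {x} → last xs ≡ just x → x ∈ xs
  last-∈ (y ∷ []) refl = here refl
  last-∈ (y ∷ z ∷ ys) eq = there (last-∈ (z ∷ ys) eq)

  head-++ : ∀ (xs ys : List A) {s} → head xs ≡ just s → head (xs ++ ys) ≡ just s
  head-++ (x ∷ xs) ys refl = refl

  last-++ : ∀ (xs ys : List A) {t} → last ys ≡ just t → last (xs ++ ys) ≡ just t
  last-++ [] ys eq = eq
  last-++ (x ∷ []) (y ∷ ys) eq = eq
  last-++ (x ∷ x' ∷ xs) (y ∷ ys) eq = last-++ (x' ∷ xs) (y ∷ ys) eq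

  linked-++ : ∀ {R : A → A → Set} {xs ys : List A} {a b} → Linked R xs → Linked R ys →
              last xs ≡ just a → head ys ≡ just b → R a b → Linked R (xs ++ ys)
  linked-++ {R} lx ly la hb r = LinkedProps.++⁺ lx (subst₂ (Connected R) (sym la) (sym hb) (just r)) ly

  linked-++ˡ : ∀ {R : A → A → Set} (xs : List A) {ys} → Linked R (xs ++ ys) → Linked R xs
  linked-++ˡ [] _ = []
  linked-++ˡ (x ∷ []) _ = [-]
  linked-++ˡ (x ∷ y ∷ xs) (r ∷ l) = r ∷ linked-++ˡ (y ∷ xs) l

  linked-++ʳ : ∀ {R : A → A → Set} (xs : List A) {ys} → Linked R (xs ++ ys) → Linked R ys
  linked-++ʳ [] l = l
  linked-++ʳ (x ∷ []) [-] = []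
  linked-++ʳ (x ∷ []) (r ∷ l) = l
  linked-++ʳ (x ∷ y ∷ xs) (r ∷ l) = linked-++ʳ (y ∷ xs) l

  linked-junction : ∀ {R : A → A → Set} (xs : List A) {u v ys} → Linked R (xs ++ u ∷ v ∷ ys) → R u v
  linked-junction [] (r ∷ _) = r
  linked-junction (x ∷ xs) l = linked-junction xs (linked-++ʳ (x ∷ []) l)

  last-++-∷ : ∀ (xs : List A) y ys → last (xs ++ y ∷ ys) ≡ last (y ∷ ys)
  last-++-∷ [] y ys = refl
  last-++-∷ (x ∷ []) y ys = refl
  last-++-∷ (x ∷ x' ∷ xs) y ys = last-++-∷ (x' ∷ xs) y ys

  head-snoc-++ : ∀ (xs : List A) y ys → head ((xs ++ y ∷ []) ++ ys) ≡ head (xs ++ y ∷ [])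
  head-snoc-++ [] y ys = refl
  head-snoc-++ (x ∷ xs) y ys = refl

  first-exit : ∀ {P : A → Set} → Decidable P → ∀ x xs → P x → ¬ All P (x ∷ xs) →
    ∃[ as ] ∃[ u ] ∃[ v ] ∃[ rs ] (x ∷ xs ≡ as ++ u ∷ v ∷ rs) × All P (as ++ u ∷ []) × ¬ P v
  first-exit P? x [] px ¬all = ⊥-elim (¬all (px ∷ []))
  first-exit P? x (y ∷ ys) px ¬all with P? y
  ... | no ¬py = [] , x , y , ys , refl , px ∷ [] , ¬py
  ... | yes py with first-exit P? y ys py (λ a → ¬all (px ∷ a))
  ...   | as , u , v , rs , eq , pas , ¬pv = x ∷ as , u , v , rs , cong (x ∷_) eq , px ∷ pas , ¬pv

  last-entry : ∀ {P : A → Set} → Decidable P → ∀ xs {t} → last xs ≡ just t → P t → ¬ All P xs →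
    ∃[ rs ] ∃[ v ] ∃[ u ] ∃[ bs ] (xs ≡ rs ++ v ∷ u ∷ bs) × All P (u ∷ bs) × ¬ P v
  last-entry P? (x ∷ []) refl pt ¬all = ⊥-elim (¬all (pt ∷ []))
  last-entry {P} P? (x ∷ y ∷ ys) lt pt ¬all =
    extend (All.all? P? (y ∷ ys)) (last-entry P? (y ∷ ys) lt pt)
    where
    Entry : List A → Set
    Entry zs = ∃[ rs ] ∃[ v ] ∃[ u ] ∃[ bs ] (zs ≡ rs ++ v ∷ u ∷ bs) × All P (u ∷ bs) × ¬ P v
    extend : Dec (All P (y ∷ ys)) → (¬ All P (y ∷ ys) → Entry (y ∷ ys)) → Entry (x ∷ y ∷ ys)
    extend (yes all-y) _ = [] , x , y , ys , refl , all-y , λ px → ¬all (px ∷ all-y)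
    extend (no ¬all-y) tail-entry with tail-entry ¬all-y
    ... | rs , v , u , bs , eq , pbs , ¬pv = x ∷ rs , v , u , bs , cong (x ∷_) eq , pbs , ¬pv

module _ {A B : Set} where

  linked-map : ∀ {R : A → A → Set} {S : B → B → Set} {P : A → Set} (f : A → B) →
    (∀ {x y} → P x → P y → R x y → S (f x) (f y)) →
    ∀ {xs} → Linked R xs → All P xs → Linked S (map f xs)
  linked-map f h [] _ = []
  linked-map f h [-] _ = [-]
  linked-map f h (r ∷ l) (px ∷ py ∷ ps) = h px py r ∷ linked-map f h l (py ∷ ps)

  unique-map : ∀ {P : A → Set} (f : A → B) →
    (∀ {x y} → P x → P y → f x ≡ f y → x ≡ y) →
    ∀ {xs} → Unique xs → All P xs → Unique (map f xs)
  unique-map f inj [] [] = []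
  unique-map {P} f inj {x ∷ xs} (x∉ ∷ u) (px ∷ ps) = distinct x∉ ps ∷ unique-map f inj u ps
    where
    distinct : ∀ {ys} → All (x ≢_) ys → All P ys → All (f x ≢_) (map f ys)
    distinct [] [] = []
    distinct (ne ∷ nes) (py ∷ pys) = (λ eq → ne (inj px py eq)) ∷ distinct nes pys

  head-map : ∀ (f : A → B) xs {s} → head xs ≡ just s → head (map f xs) ≡ just (f s)
  head-map f (x ∷ xs) refl = refl

  last-map : ∀ (f : A → B) xs {t} → last xs ≡ just t → last (map f xs) ≡ just (f t)
  last-map f (x ∷ []) refl = refl
  last-map f (x ∷ y ∷ xs) eq = last-map f (y ∷ xs) eq

open ListFacts
open Positions

-- An induced path P from s to t: every edge of G between vertices of P is
-- an edge of P.  Indexing P by positions 0, …, len-1, every edge inside P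
-- changes the position by exactly one, which makes the structure of walks
-- inside P one-dimensional.

Induced : ∀ {n} → Graph n → List (Fin n) → Set
Induced G P = ∀ {u v} → u ∈ P → v ∈ P → Adj G u v → EdgeOf P u v

join-paths : ∀ {n} {G : Graph n} {a b c d A B} → IsPath G a b A → IsPath G c d B →
             Adj G b c → Disjoint A B → IsPath G a d (A ++ B)
join-paths {A = A} {B} (walkA , uniqA , hdA , ltA) (walkB , uniqB , hdB , ltB) bc apart =
    linked-++ walkA walkB ltA hdB bc
  , Unique.++⁺ uniqA uniqB (λ (v∈A , v∈B) → apart _ v∈A v∈B)
  , head-++ A B hdA
  , last-++ A B ltB

module InducedPath {n : ℕ} (G : Graph n) {s t : Fin n} (P : List (Fin n))
                   (path : IsPath G s t P) (induced : Induced G P) where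

  private
    linked = proj₁ path
    unique = proj₁ (proj₂ path)
    starts = proj₁ (proj₂ (proj₂ path))
    ends   = proj₂ (proj₂ (proj₂ path))

  len : ℕ
  len = length P

  vertexAt : ℕ → Fin n
  vertexAt = nth P s

  pos : Fin n → ℕ
  pos = idx P

  vertexAt-pos : ∀ {v} → v ∈ P → vertexAt (pos v) ≡ v
  vertexAt-pos = nth-idx s P

  pos-vertexAt : ∀ {h} → h < len → pos (vertexAt h) ≡ h
  pos-vertexAt {h} = idx-nth s P h unique

  vertexAt-∈ : ∀ {h} → h < len → vertexAt h ∈ P
  vertexAt-∈ {h} = nth-∈ s P h

  pos-< : ∀ {v} → v ∈ P → pos v < len
  pos-< = idx-< P

  pos-injective : ∀ {u v} → u ∈ P → v ∈ P → pos u ≡ pos v → u ≡ v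
  pos-injective u∈ v∈ eq = trans (sym (vertexAt-pos u∈)) (trans (cong vertexAt eq) (vertexAt-pos v∈))

  s∈ : s ∈ P
  s∈ = head-∈ P starts

  t∈ : t ∈ P
  t∈ = last-∈ P ends

  0<len : 0 < len
  0<len = ≤-<-trans z≤n (pos-< s∈)

  end : ℕ
  end = pred len

  end<len : end < len
  end<len = pred< 0<len
    where pred< : ∀ {m} → 0 < m → pred m < m
          pred< {suc m} _ = ≤-refl

  ≤-end : ∀ {a} → a < len → a ≤ end
  ≤-end = <⇒≤pred

  vertexAt-0 : vertexAt 0 ≡ s
  vertexAt-0 = nth-head s P starts

  vertexAt-last : vertexAt end ≡ t
  vertexAt-last = nth-last s P ends

  pos-s : pos s ≡ 0
  pos-s = trans (cong pos (sym vertexAt-0)) (pos-vertexAt 0<len)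

  pos-t : pos t ≡ end
  pos-t = trans (cong pos (sym vertexAt-last)) (pos-vertexAt end<len)

  edge-pos-step : ∀ {u v} → EdgeOf P u v → Step (pos u) (pos v)
  edge-pos-step = edge-step unique

  adj-step : ∀ {u v} → u ∈ P → v ∈ P → Adj G u v → Step (pos u) (pos v)
  adj-step u∈ v∈ uv = edge-pos-step (induced u∈ v∈ uv)

  positions-edge : ∀ {a b} → a < len → b < len → Step a b → EdgeOf P (vertexAt a) (vertexAt b)
  positions-edge {a} _ b<len (inj₁ refl) = inj₁ (nth-consec s P a b<len)
  positions-edge {a} {b} a<len _ (inj₂ refl) = inj₂ (nth-consec s P b a<len)

  step-adj : ∀ {a b} → a < len → b < len → Step a b → Adj G (vertexAt a) (vertexAt b)
  step-adj {a} _ b<len (inj₁ refl) = nth-linked s P linked a b<len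
  step-adj {a} {b} a<len _ (inj₂ refl) = Graph.sym G (nth-linked s P linked b a<len)

  -- positions of a walk inside P: a unit-step walk which, by the
  -- intermediate value theorem, covers every position between its ends
  walk-covers : ∀ {R : Fin n → Fin n → Set} → (∀ {u v} → u ∈ P → v ∈ P → R u v → Step (pos u) (pos v)) →
                ∀ {u v h} ws → Linked R ws → All (_∈ P) ws → head ws ≡ just u → last ws ≡ just v →
                Between (pos u) (pos v) h → vertexAt h ∈ ws
  walk-covers step ws walk inside hd lt between
    with ∈-map⁻ pos (visits-between (map pos ws) (linked-map pos step walk inside)
                                    (head-map pos ws hd) (last-map pos ws lt) between)
  ... | w , w∈ , refl = subst (_∈ ws) (sym (vertexAt-pos (All.lookup inside w∈))) w∈

  subpath : ℕ → ℕ → List (Fin n)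
  subpath i j = map vertexAt (segment i j)

  private
    segment-<len : ∀ {i j} → i < len → j < len → All (_< len) (segment i j)
    segment-<len {i} {j} i< j< = All.tabulate λ p → between-< i< j< (segment-between i j p)

  subpath-∈ : ∀ {z i j} → i < len → j < len → z ∈ subpath i j → z ∈ P × Between i j (pos z)
  subpath-∈ {i = i} {j} i< j< z∈ with ∈-map⁻ vertexAt z∈
  ... | h , h∈ , refl = vertexAt-∈ h< , subst (Between i j) (sym (pos-vertexAt h<)) (segment-between i j h∈)
    where h< = All.lookup (segment-<len i< j<) h∈

  subpath-head : ∀ i j → head (subpath i j) ≡ just (vertexAt i)
  subpath-head i j = head-map vertexAt (segment i j) (segment-head i j)

  subpath-last : ∀ i j → last (subpath i j) ≡ just (vertexAt j)
  subpath-last i j = last-map vertexAt (segment i j) (segment-last i j)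

  subpath-edges : ∀ {i j} → i < len → j < len → Linked (EdgeOf P) (subpath i j)
  subpath-edges {i} {j} i< j< = linked-map vertexAt positions-edge (segment-steps i j) (segment-<len i< j<)

  subpath-isPath : ∀ {i j} → i < len → j < len → IsPath G (vertexAt i) (vertexAt j) (subpath i j)
  subpath-isPath {i} {j} i< j< =
      linked-map vertexAt step-adj (segment-steps i j) (segment-<len i< j<)
    , unique-map vertexAt (λ a< b< eq → trans (sym (pos-vertexAt a<)) (trans (cong pos eq) (pos-vertexAt b<)))
                 (segment-unique i j) (segment-<len i< j<)
    , subpath-head i j
    , subpath-last i j

  initial-path : ∀ {a} → a < len → IsPath G s (vertexAt a) (subpath 0 a)
  initial-path {a} a< = subst (λ x → IsPath G x (vertexAt a) (subpath 0 a)) vertexAt-0 (subpath-isPath 0<len a<)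

  final-path : ∀ {a} → a < len → IsPath G (vertexAt a) t (subpath a end)
  final-path {a} a< = subst (λ y → IsPath G (vertexAt a) y (subpath a end)) vertexAt-last (subpath-isPath a< end<len)

  initial-∈ : ∀ {a z} → a < len → z ∈ subpath 0 a → z ∈ P × pos z ≤ a
  initial-∈ a< z∈ = let (z∈P , between) = subpath-∈ 0<len a< z∈ in z∈P , between-≤ z≤n ≤-refl between

  final-∈ : ∀ {a z} → a < len → z ∈ subpath a end → z ∈ P × a ≤ pos z
  final-∈ a< z∈ = let (z∈P , between) = subpath-∈ a< end<len z∈ in z∈P , between-≥ ≤-refl (≤-end a<) between

  P-as-positions : P ≡ map vertexAt (ascending 0 end)
  P-as-positions = from-head P starts
    where from-head : ∀ xs → head xs ≡ just s → xs ≡ map (nth xs s) (ascending 0 (pred (length xs)))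
          from-head (x ∷ xs) _ = list-as-positions s x xs

  -- the only path from s to t using vertices of P only is P itself: its
  -- positions form a repetition-free unit-step walk from 0 to end
  only-path-inside : ∀ Q → IsPath G s t Q → All (_∈ P) Q → Q ≡ P
  only-path-inside (q ∷ qs) (walk , uniq , refl , lt) inside = begin
    q ∷ qs                               ≡⟨ sym (map-vertexAt-pos inside) ⟩
    map vertexAt (map pos (q ∷ qs))      ≡⟨ cong (map vertexAt) positions-ascend ⟩
    map vertexAt (ascending 0 k)         ≡⟨ cong (λ m → map vertexAt (ascending 0 m)) k≡end ⟩
    map vertexAt (ascending 0 end)       ≡⟨ sym P-as-positions ⟩
    P                                    ∎
    where
    open ≡-Reasoning
    k = length (map pos qs)
    map-vertexAt-pos : ∀ {ws} → All (_∈ P) ws → map vertexAt (map pos ws) ≡ ws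
    map-vertexAt-pos [] = refl
    map-vertexAt-pos (w∈ ∷ ws∈) = cong₂ _∷_ (vertexAt-pos w∈) (map-vertexAt-pos ws∈)
    pos-q : map pos (q ∷ qs) ≡ 0 ∷ map pos qs
    pos-q = cong (_∷ map pos qs) pos-s
    positions-ascend : map pos (q ∷ qs) ≡ ascending 0 k
    positions-ascend = trans pos-q (ascending-walk 0 (map pos qs)
      (subst (Linked Step) pos-q (linked-map pos adj-step walk inside))
      (subst Unique pos-q (unique-map pos pos-injective uniq inside))
      (λ _ ()))
    k≡end : k ≡ end
    k≡end = just-injective (begin
      just k                          ≡⟨ sym (ascending-last 0 k) ⟩
      last (ascending 0 k)            ≡⟨ cong last (sym positions-ascend) ⟩
      last (map pos (q ∷ qs))         ≡⟨ last-map pos (q ∷ qs) lt ⟩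
      just (pos t)                    ≡⟨ cong just pos-t ⟩
      just end                        ∎)

  record Departure (Q : List (Fin n)) : Set where
    field
      at     : ℕ
      at<len : at < len
      to     : Fin n
      to∉P   : to ∉ P
      to∈Q   : to ∈ Q
      adj    : Adj G (vertexAt at) to
      covers : ∀ h → h ≤ at → vertexAt h ∈ Q

  record Arrival (Q : List (Fin n)) : Set where
    field
      at     : ℕ
      at<len : at < len
      from   : Fin n
      from∉P : from ∉ P
      from∈Q : from ∈ Q
      adj    : Adj G (vertexAt at) from
      covers : ∀ h → at ≤ h → h < len → vertexAt h ∈ Q

  private
    open import Data.List.Membership.DecPropositional (Fin._≟_ {n}) using (_∈?_)
    _∈P? : Decidable (_∈ P)
    v ∈P? = v ∈? P

  -- the run of Q before its first exit is a walk inside P from position 0,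
  -- so it covers every position up to the exit point (dually for arrival)
  departure : ∀ Q → IsPath G s t Q → ¬ All (_∈ P) Q → Departure Q
  departure (q ∷ qs) (walk , _ , refl , _) ¬inside
    with first-exit _∈P? q qs s∈ ¬inside
  ... | as , u , v , rs , Q≡ , run∈P , v∉P = record
    { at = pos u ; at<len = pos-< u∈P ; to = v ; to∉P = v∉P
    ; to∈Q = subst (v ∈_) (sym Q≡) (∈-++⁺ʳ as (there (here refl)))
    ; adj = subst (λ w → Adj G w v) (sym (vertexAt-pos u∈P)) (linked-junction as (subst (Linked (Adj G)) Q≡ walk))
    ; covers = λ h h≤ → subst (vertexAt h ∈_) (sym Q≡′)
                          (∈-++⁺ˡ (walk-covers adj-step run run-walk run∈P run-head (last-++-∷ as u [])
                                                (inj₁ (subst (_≤ h) (sym pos-s) z≤n , h≤))))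
    }
    where
    run = as ++ u ∷ []
    Q≡′ : q ∷ qs ≡ run ++ v ∷ rs
    Q≡′ = trans Q≡ (sym (++-assoc as (u ∷ []) (v ∷ rs)))
    u∈P = All.lookup run∈P (∈-++⁺ʳ as (here refl))
    run-walk : Linked (Adj G) run
    run-walk = linked-++ˡ run (subst (Linked (Adj G)) Q≡′ walk)
    run-head : head run ≡ just q
    run-head = trans (sym (head-snoc-++ as u (v ∷ rs))) (cong head (sym Q≡′))

  arrival : ∀ Q → IsPath G s t Q → ¬ All (_∈ P) Q → Arrival Q
  arrival Q (walk , _ , _ , lt) ¬inside
    with last-entry _∈P? Q lt t∈ ¬inside
  ... | rs , v , u , bs , Q≡ , run∈P , v∉P = record
    { at = pos u ; at<len = pos-< u∈P ; from = v ; from∉P = v∉P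
    ; from∈Q = subst (v ∈_) (sym Q≡) (∈-++⁺ʳ rs (here refl))
    ; adj = subst (λ w → Adj G w v) (sym (vertexAt-pos u∈P))
                  (Graph.sym G (linked-junction rs (subst (Linked (Adj G)) Q≡ walk)))
    ; covers = λ h at≤h h< → subst (vertexAt h ∈_) (sym Q≡′)
                               (∈-++⁺ʳ (rs ++ v ∷ []) (walk-covers adj-step (u ∷ bs) run-walk run∈P refl run-last
                                  (inj₁ (at≤h , subst (h ≤_) (sym pos-t) (≤-end h<)))))
    }
    where
    Q≡′ : Q ≡ (rs ++ v ∷ []) ++ u ∷ bs
    Q≡′ = trans Q≡ (sym (++-assoc rs (v ∷ []) (u ∷ bs)))
    u∈P = All.lookup run∈P (here refl)
    run-walk : Linked (Adj G) (u ∷ bs)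
    run-walk = linked-++ʳ (rs ++ v ∷ []) (subst (Linked (Adj G)) Q≡′ walk)
    run-last : last (u ∷ bs) ≡ just t
    run-last = trans (sym (last-++-∷ (rs ++ v ∷ []) u bs)) (trans (cong last (sym Q≡′)) lt)

  edge-end-∈ : ∀ {u v} → EdgeOf P u v → v ∈ P
  edge-end-∈ (inj₁ (xs , _ , refl)) = ∈-++⁺ʳ xs (there (here refl))
  edge-end-∈ (inj₂ (xs , _ , refl)) = ∈-++⁺ʳ xs (here refl)

  IntervalClasses : {B : Set} → (Fin n → B) → Set
  IntervalClasses β = ∀ {i j h} → i < len → j < len → β (vertexAt i) ≡ β (vertexAt j) →
                      Between i j h → β (vertexAt h) ≡ β (vertexAt i)

  ClassWalk : {B : Set} → (Fin n → Fin n → Set) → (Fin n → B) → Fin n → Fin n → Set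
  ClassWalk R β u v = ∃[ w ] (Linked R w × head w ≡ just u × last w ≡ just v × All (λ z → β z ≡ β u) w)

  interval-class-walk : ∀ {B : Set} {β : Fin n → B} → IntervalClasses β →
                        ∀ {u v} → u ∈ P → v ∈ P → β u ≡ β v → ClassWalk (EdgeOf P) β u v
  interval-class-walk {β = β} intervals {u} {v} u∈ v∈ βu≡βv =
      subpath (pos u) (pos v)
    , subpath-edges pos-u< pos-v<
    , trans (subpath-head (pos u) (pos v)) (cong just (vertexAt-pos u∈))
    , trans (subpath-last (pos u) (pos v)) (cong just (vertexAt-pos v∈))
    , All.tabulate same-label
    where
    pos-u< = pos-< u∈
    pos-v< = pos-< v∈
    ends-equal : β (vertexAt (pos u)) ≡ β (vertexAt (pos v))
    ends-equal = trans (cong β (vertexAt-pos u∈)) (trans βu≡βv (cong β (sym (vertexAt-pos v∈))))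
    same-label : ∀ {z} → z ∈ subpath (pos u) (pos v) → β z ≡ β u
    same-label {z} z∈ with subpath-∈ pos-u< pos-v< z∈
    ... | z∈P , between = begin
      β z                       ≡⟨ cong β (sym (vertexAt-pos z∈P)) ⟩
      β (vertexAt (pos z))      ≡⟨ intervals pos-u< pos-v< ends-equal between ⟩
      β (vertexAt (pos u))      ≡⟨ cong β (vertexAt-pos u∈) ⟩
      β u                       ∎
      where open ≡-Reasoning

  -- Conversely, suppose the classes of β are connected by R-walks and an
  -- R-step leaving a vertex of P is an edge of P (as for the path edges of
  -- a linkage).  Then a class meeting P stays inside P, and it is an
  -- interval of P because the walk inside it visits all positions between.
  module ConnectedClasses {R : Fin n → Fin n → Set} (stay : ∀ {u v} → R u v → u ∈ P → EdgeOf P u v)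
           {B : Set} (β : Fin n → B) (class-walk : ∀ u v → β u ≡ β v → ClassWalk R β u v) where

    walk-inside : ∀ {x} xs → Linked R (x ∷ xs) → x ∈ P → All (_∈ P) (x ∷ xs)
    walk-inside [] _ x∈ = x∈ ∷ []
    walk-inside (y ∷ ys) (r ∷ rs) x∈ = x∈ ∷ walk-inside ys rs (edge-end-∈ (stay r x∈))

    class-inside : ∀ {u v} → β u ≡ β v → u ∈ P → v ∈ P
    class-inside {u} {v} βu≡βv u∈ with class-walk u v βu≡βv
    ... | x ∷ xs , walk , refl , lt , _ = All.lookup (walk-inside xs walk u∈) (last-∈ (x ∷ xs) lt)

    class-interval : IntervalClasses β
    class-interval {i} {j} i< j< βi≡βj between with class-walk (vertexAt i) (vertexAt j) βi≡βj
    ... | x ∷ xs , walk , refl , lt , same =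
      All.lookup same (walk-covers (λ u∈ _ r → edge-pos-step (stay r u∈)) (x ∷ xs) walk
                                   (walk-inside xs walk (vertexAt-∈ i<)) refl lt
                                   (subst₂ (λ a b → Between a b _) (sym (pos-vertexAt i<)) (sym (pos-vertexAt j<)) between))

    initial-class : ∀ {i j} → i < len → j < len → β (vertexAt i) ≡ β s → β (vertexAt j) ≢ β s → i < j
    initial-class {i} {j} i< j< βi βj = ≰⇒> λ j≤i → βj (begin
      β (vertexAt j)  ≡⟨ class-interval 0<len i< (trans (cong β vertexAt-0) (sym βi)) (inj₁ (z≤n , j≤i)) ⟩
      β (vertexAt 0)  ≡⟨ cong β vertexAt-0 ⟩
      β s             ∎)
      where open ≡-Reasoning

    final-class : ∀ {i j} → i < len → j < len → β (vertexAt i) ≡ β t → β (vertexAt j) ≢ β t → j < i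
    final-class {i} {j} i< j< βi βj = ≰⇒> λ i≤j → βj (begin
      β (vertexAt j)    ≡⟨ class-interval end<len i< (trans (cong β vertexAt-last) (sym βi)) (inj₂ (i≤j , ≤-end j<)) ⟩
      β (vertexAt end)  ≡⟨ cong β vertexAt-last ⟩
      β t               ∎)
      where open ≡-Reasoning

    leaves-initial-class : DecidableEquality B → β t ≢ β s →
                           ∃[ h ] (suc h < len × β (vertexAt h) ≡ β s × β (vertexAt (suc h)) ≢ β s)
    leaves-initial-class _≟B_ t≢s
      with first-change (λ h → β (vertexAt h) ≟B β s) end (cong β vertexAt-0)
                        (λ same → t≢s (trans (cong β (sym vertexAt-last)) same))
    ... | h , h<end , in-class , next-out = h , <-≤-trans (s≤s h<end) end<len , in-class , next-out

module ChordlessLinkage {n : ℕ} {G : Graph n} (L : Linkage2 G)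
                        (spanning : Spanning L) (chordless : Chordless L) where

  open import Data.List.Membership.DecPropositional (Fin._≟_ {n}) using (_∈?_)

  apart : ∀ {v} → v ∈ P₁ L → v ∈ P₂ L → ⊥
  apart {v} = disjoint L v

  outside₁ : ∀ {v} → v ∉ P₁ L → v ∈ P₂ L
  outside₁ {v} v∉ with spanning v
  ... | inj₁ v∈ = ⊥-elim (v∉ v∈)
  ... | inj₂ v∈ = v∈

  outside₂ : ∀ {v} → v ∉ P₂ L → v ∈ P₁ L
  outside₂ {v} v∉ with spanning v
  ... | inj₁ v∈ = v∈
  ... | inj₂ v∈ = ⊥-elim (v∉ v∈)

  edge-start-∈ : ∀ {P : List (Fin n)} {u v} → EdgeOf P u v → u ∈ P
  edge-start-∈ (inj₁ (xs , _ , refl)) = ∈-++⁺ʳ xs (here refl)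
  edge-start-∈ (inj₂ (xs , _ , refl)) = ∈-++⁺ʳ xs (there (here refl))

  stay₁ : ∀ {u v} → PathEdge L u v → u ∈ P₁ L → EdgeOf (P₁ L) u v
  stay₁ (inj₁ e) _ = e
  stay₁ (inj₂ e) u∈ = ⊥-elim (apart u∈ (edge-start-∈ e))

  stay₂ : ∀ {u v} → PathEdge L u v → u ∈ P₂ L → EdgeOf (P₂ L) u v
  stay₂ (inj₁ e) u∈ = ⊥-elim (apart (edge-start-∈ e) u∈)
  stay₂ (inj₂ e) _ = e

  -- Since L has no chords, each of its paths is induced: an edge inside
  -- Pᵢ that is not a path edge would be a chord.
  induced : ∀ {P : List (Fin n)} {d} → Unique P →
            (∀ {u v} → PathEdge L u v → u ∈ P → EdgeOf P u v) →
            (∀ {u v} → u ∈ P → v ∈ P → SameComponent L u v) → Induced G P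
  induced {P} {d} uniq stay same {u} {v} u∈ v∈ uv with step? (idx P u) (idx P v)
  ... | yes step = step-edge d P u∈ v∈ step
  ... | no ¬step = ⊥-elim (chordless u v (uv , (λ pe → ¬step (edge-step uniq (stay pe u∈))) , same u∈ v∈))

  module S₁ = InducedPath G (P₁ L) (isPath₁ L)
                (induced {d = s₁ L} (proj₁ (proj₂ (isPath₁ L))) stay₁ (λ u∈ v∈ → inj₁ (u∈ , v∈)))
  module S₂ = InducedPath G (P₂ L) (isPath₂ L)
                (induced {d = s₂ L} (proj₁ (proj₂ (isPath₂ L))) stay₂ (λ u∈ v∈ → inj₂ (u∈ , v∈)))

  -- Labelling positions by three consecutive intervals [0, lo], (lo, hi)
  -- and [hi, ∞) with the K_{2,4}-vertices inj₂ a, inj₁ x and inj₂ b: this is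
  -- how the branch sets of the XX minor constructed below cut a path of L.
  module Trisection {lo hi : ℕ} (lo<hi : lo < hi) (a : Fin 4) (x : Fin 2) (b : Fin 4) where

    data Region (h : ℕ) : Set where
      low    : h ≤ lo → Region h
      middle : lo < h → h < hi → Region h
      high   : hi ≤ h → Region h

    region : ∀ h → Region h
    region h with h ≤? lo | hi ≤? h
    ... | yes h≤lo | _ = low h≤lo
    ... | no _ | yes hi≤h = high hi≤h
    ... | no h≰lo | no hi≰h = middle (≰⇒> h≰lo) (≰⇒> hi≰h)

    regionLabel : ∀ {h} → Region h → K24 L
    regionLabel (low _) = inj₂ a
    regionLabel (middle _ _) = inj₁ x
    regionLabel (high _) = inj₂ b

    -- the regions are disjoint, so the label does not depend on the witness
    label-unique : ∀ {h} (r r' : Region h) → regionLabel r ≡ regionLabel r'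
    label-unique (low _) (low _) = refl
    label-unique (middle _ _) (middle _ _) = refl
    label-unique (high _) (high _) = refl
    label-unique (low h≤lo) (middle lo<h _) = ⊥-elim (<⇒≱ lo<h h≤lo)
    label-unique (middle lo<h _) (low h≤lo) = ⊥-elim (<⇒≱ lo<h h≤lo)
    label-unique (middle _ h<hi) (high hi≤h) = ⊥-elim (<⇒≱ h<hi hi≤h)
    label-unique (high hi≤h) (middle _ h<hi) = ⊥-elim (<⇒≱ h<hi hi≤h)
    label-unique (low h≤lo) (high hi≤h) = ⊥-elim (<⇒≱ lo<hi (≤-trans hi≤h h≤lo))
    label-unique (high hi≤h) (low h≤lo) = ⊥-elim (<⇒≱ lo<hi (≤-trans hi≤h h≤lo))

    label : ℕ → K24 L
    label h = regionLabel (region h)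

    label-low : ∀ {h} → h ≤ lo → label h ≡ inj₂ a
    label-low {h} h≤lo = label-unique (region h) (low h≤lo)

    label-middle : ∀ {h} → lo < h → h < hi → label h ≡ inj₁ x
    label-middle {h} lo<h h<hi = label-unique (region h) (middle lo<h h<hi)

    label-high : ∀ {h} → hi ≤ h → label h ≡ inj₂ b
    label-high {h} hi≤h = label-unique (region h) (high hi≤h)

    label-interval : a ≢ b → ∀ {i j h} → label i ≡ label j → Between i j h → label h ≡ label i
    label-interval a≢b {i} {j} {h} same between = classes (region i) (region j) same
      where
      classes : (ri : Region i) (rj : Region j) → regionLabel ri ≡ regionLabel rj → label h ≡ regionLabel ri
      classes (low i≤) (low j≤) _ = label-low (between-≤ i≤ j≤ between)
      classes (middle lo<i i<hi) (middle lo<j j<hi) _ =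
        label-middle (between-≥ lo<i lo<j between) (between-< i<hi j<hi between)
      classes (high ≤i) (high ≤j) _ = label-high (between-≥ ≤i ≤j between)
      classes (low _) (high _) a≡b = ⊥-elim (a≢b (inj₂-injective a≡b))
      classes (high _) (low _) b≡a = ⊥-elim (a≢b (sym (inj₂-injective b≡a)))
      classes (low _) (middle _ _) ()
      classes (middle _ _) (low _) ()
      classes (middle _ _) (high _) ()
      classes (high _) (middle _ _) ()

    label-step : suc lo < hi → ∀ {i j} → Step i j → label i ≢ label j → K24Adj L (label i) (label j)
    label-step gap {i} {j} step differ = boundary (region i) (region j) differ
      where
      far : ∀ {i j} → Step i j → i ≤ lo → hi ≤ j → ⊥
      far (inj₁ refl) i≤lo hi≤j = <⇒≱ gap (≤-trans hi≤j (s≤s i≤lo))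
      far {j = j} (inj₂ refl) i≤lo hi≤j =
        <⇒≱ gap (≤-trans hi≤j (≤-trans (n≤1+n j) (≤-trans i≤lo (n≤1+n lo))))
      boundary : (ri : Region i) (rj : Region j) → regionLabel ri ≢ regionLabel rj →
                 K24Adj L (regionLabel ri) (regionLabel rj)
      boundary (low _) (middle _ _) _ = tt
      boundary (middle _ _) (low _) _ = tt
      boundary (middle _ _) (high _) _ = tt
      boundary (high _) (middle _ _) _ = tt
      boundary (low _) (low _) differ = ⊥-elim (differ refl)
      boundary (middle _ _) (middle _ _) differ = ⊥-elim (differ refl)
      boundary (high _) (high _) differ = ⊥-elim (differ refl)
      boundary (low i≤lo) (high hi≤j) _ = ⊥-elim (far step i≤lo hi≤j)
      boundary (high hi≤i) (low j≤lo) _ = ⊥-elim (far (swap step) j≤lo hi≤i)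

  pred-step : ∀ {m k} → m < k → suc (pred k) ≡ k
  pred-step {k = suc k} _ = refl

  -- Two disjoint s₁–t₁ and s₂–t₂ paths Q₁, Q₂ which both leave the paths of
  -- L yield an XX minor.  Q₁ covers P₁ outside the open interval between its
  -- departure and arrival positions, so Q₂ meets P₁ only inside it (and
  -- symmetrically).  Cutting each Pᵢ into these three intervals gives the
  -- branch sets: the outer ones are the terminal vertices of K_{2,4}, the
  -- middle ones its two degree-4 vertices, joined to all four terminal
  -- sets by path edges and by the rungs where Q₁ and Q₂ leave and return.
  module MinorFromDetours {Q₁ Q₂ : List (Fin n)} (apartQ : Disjoint Q₁ Q₂)
         (d₁ : S₁.Departure Q₁) (a₁ : S₁.Arrival Q₁)
         (d₂ : S₂.Departure Q₂) (a₂ : S₂.Arrival Q₂) where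

    module D₁ = S₁.Departure d₁
    module A₁ = S₁.Arrival a₁
    module D₂ = S₂.Departure d₂
    module A₂ = S₂.Arrival a₂

    inside-gap₁ : ∀ {w} → w ∈ P₁ L → w ∈ Q₂ → D₁.at < S₁.pos w × S₁.pos w < A₁.at
    inside-gap₁ {w} w∈P w∈Q =
        ≰⇒> (λ pos≤ → apartQ w (subst (_∈ Q₁) (S₁.vertexAt-pos w∈P) (D₁.covers _ pos≤)) w∈Q)
      , ≰⇒> (λ ≤pos → apartQ w (subst (_∈ Q₁) (S₁.vertexAt-pos w∈P) (A₁.covers _ ≤pos (S₁.pos-< w∈P))) w∈Q)

    inside-gap₂ : ∀ {w} → w ∈ P₂ L → w ∈ Q₁ → D₂.at < S₂.pos w × S₂.pos w < A₂.at
    inside-gap₂ {w} w∈P w∈Q =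
        ≰⇒> (λ pos≤ → apartQ w w∈Q (subst (_∈ Q₂) (S₂.vertexAt-pos w∈P) (D₂.covers _ pos≤)))
      , ≰⇒> (λ ≤pos → apartQ w w∈Q (subst (_∈ Q₂) (S₂.vertexAt-pos w∈P) (A₂.covers _ ≤pos (S₂.pos-< w∈P))))

    -- the middle intervals are nonempty: they contain the rung ends of the
    -- other path
    gap₁ : suc D₁.at < A₁.at
    gap₁ = let (lo< , <hi) = inside-gap₁ (outside₂ D₂.to∉P) D₂.to∈Q in ≤-<-trans lo< <hi

    gap₂ : suc D₂.at < A₂.at
    gap₂ = let (lo< , <hi) = inside-gap₂ (outside₁ D₁.to∉P) D₁.to∈Q in ≤-<-trans lo< <hi

    module T₁ = Trisection (<-trans (n<1+n _) gap₁) Fin.zero Fin.zero (Fin.suc Fin.zero)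
    module T₂ = Trisection (<-trans (n<1+n _) gap₂) (Fin.suc (Fin.suc Fin.zero)) (Fin.suc Fin.zero)
                           (Fin.suc (Fin.suc (Fin.suc Fin.zero)))

    β : Fin n → K24 L
    β v with v ∈? P₁ L
    ... | yes _ = T₁.label (S₁.pos v)
    ... | no _ = T₂.label (S₂.pos v)

    β₁ : ∀ {v} → v ∈ P₁ L → β v ≡ T₁.label (S₁.pos v)
    β₁ {v} v∈ with v ∈? P₁ L
    ... | yes _ = refl
    ... | no v∉ = ⊥-elim (v∉ v∈)

    β₂ : ∀ {v} → v ∈ P₂ L → β v ≡ T₂.label (S₂.pos v)
    β₂ {v} v∈ with v ∈? P₁ L
    ... | yes v∈₁ = ⊥-elim (apart v∈₁ v∈)
    ... | no _ = refl

    β-at₁ : ∀ {h} → h < S₁.len → β (S₁.vertexAt h) ≡ T₁.label h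
    β-at₁ h< = trans (β₁ (S₁.vertexAt-∈ h<)) (cong T₁.label (S₁.pos-vertexAt h<))

    β-at₂ : ∀ {h} → h < S₂.len → β (S₂.vertexAt h) ≡ T₂.label h
    β-at₂ h< = trans (β₂ (S₂.vertexAt-∈ h<)) (cong T₂.label (S₂.pos-vertexAt h<))

    sides-differ : ∀ h h' → T₁.label h ≢ T₂.label h'
    sides-differ h h' = differ (T₁.region h) (T₂.region h')
      where
      differ : ∀ {h h'} (r : T₁.Region h) (r' : T₂.Region h') → T₁.regionLabel r ≢ T₂.regionLabel r'
      differ (T₁.low _) (T₂.low _) ()
      differ (T₁.low _) (T₂.middle _ _) ()
      differ (T₁.low _) (T₂.high _) ()
      differ (T₁.middle _ _) (T₂.low _) ()
      differ (T₁.middle _ _) (T₂.middle _ _) ()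
      differ (T₁.middle _ _) (T₂.high _) ()
      differ (T₁.high _) (T₂.low _) ()
      differ (T₁.high _) (T₂.middle _ _) ()
      differ (T₁.high _) (T₂.high _) ()

    intervals₁ : S₁.IntervalClasses β
    intervals₁ {i} {j} {h} i< j< same between = begin
      β (S₁.vertexAt h)  ≡⟨ β-at₁ (between-< i< j< between) ⟩
      T₁.label h         ≡⟨ T₁.label-interval (λ ()) (trans (sym (β-at₁ i<)) (trans same (β-at₁ j<))) between ⟩
      T₁.label i         ≡⟨ sym (β-at₁ i<) ⟩
      β (S₁.vertexAt i)  ∎
      where open ≡-Reasoning

    intervals₂ : S₂.IntervalClasses β
    intervals₂ {i} {j} {h} i< j< same between = begin
      β (S₂.vertexAt h)  ≡⟨ β-at₂ (between-< i< j< between) ⟩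
      T₂.label h         ≡⟨ T₂.label-interval (λ ()) (trans (sym (β-at₂ i<)) (trans same (β-at₂ j<))) between ⟩
      T₂.label i         ≡⟨ sym (β-at₂ i<) ⟩
      β (S₂.vertexAt i)  ∎
      where open ≡-Reasoning

    class-walk : ∀ u v → β u ≡ β v → S₁.ClassWalk (PathEdge L) β u v
    class-walk u v same with spanning u | spanning v
    ... | inj₁ u∈ | inj₁ v∈ = let (w , edges , rest) = S₁.interval-class-walk intervals₁ u∈ v∈ same
                              in w , Linked.map inj₁ edges , rest
    ... | inj₂ u∈ | inj₂ v∈ = let (w , edges , rest) = S₂.interval-class-walk intervals₂ u∈ v∈ same
                              in w , Linked.map inj₂ edges , rest
    ... | inj₁ u∈ | inj₂ v∈ = ⊥-elim (sides-differ _ _ (trans (sym (β₁ u∈)) (trans same (β₂ v∈))))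
    ... | inj₂ u∈ | inj₁ v∈ = ⊥-elim (sides-differ _ _ (trans (sym (β₁ v∈)) (trans (sym same) (β₂ u∈))))

    terminal-label : ∀ i → β (terminal L i) ≡ inj₂ i
    terminal-label Fin.zero =
      trans (β₁ S₁.s∈) (trans (cong T₁.label S₁.pos-s) (T₁.label-low z≤n))
    terminal-label (Fin.suc Fin.zero) =
      trans (β₁ S₁.t∈) (trans (cong T₁.label S₁.pos-t) (T₁.label-high (S₁.≤-end A₁.at<len)))
    terminal-label (Fin.suc (Fin.suc Fin.zero)) =
      trans (β₂ S₂.s∈) (trans (cong T₂.label S₂.pos-s) (T₂.label-low z≤n))
    terminal-label (Fin.suc (Fin.suc (Fin.suc Fin.zero))) =
      trans (β₂ S₂.t∈) (trans (cong T₂.label S₂.pos-t) (T₂.label-high (S₂.≤-end A₂.at<len)))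

    middle-label₁ : ∀ {w} → w ∈ P₁ L → w ∈ Q₂ → β w ≡ inj₁ Fin.zero
    middle-label₁ w∈P w∈Q = let (lo< , <hi) = inside-gap₁ w∈P w∈Q in trans (β₁ w∈P) (T₁.label-middle lo< <hi)

    middle-label₂ : ∀ {w} → w ∈ P₂ L → w ∈ Q₁ → β w ≡ inj₁ (Fin.suc Fin.zero)
    middle-label₂ w∈P w∈Q = let (lo< , <hi) = inside-gap₂ w∈P w∈Q in trans (β₂ w∈P) (T₂.label-middle lo< <hi)

    Realised : K24 L → K24 L → Set
    Realised x y = ∃[ u ] ∃[ v ] (β u ≡ x × β v ≡ y × Adj G u v)

    middle-ends₁ : Realised (inj₁ Fin.zero) (inj₂ Fin.zero) × Realised (inj₁ Fin.zero) (inj₂ (Fin.suc Fin.zero))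
    middle-ends₁ =
        ( S₁.vertexAt (suc D₁.at) , S₁.vertexAt D₁.at
        , trans (β-at₁ lo+1<len) (T₁.label-middle ≤-refl gap₁) , trans (β-at₁ D₁.at<len) (T₁.label-low ≤-refl)
        , Graph.sym G (S₁.step-adj D₁.at<len lo+1<len (inj₁ refl)) )
      , ( S₁.vertexAt (pred A₁.at) , S₁.vertexAt A₁.at
        , trans (β-at₁ hi-1<len) (T₁.label-middle (<⇒≤pred gap₁) hi-1<hi) , trans (β-at₁ A₁.at<len) (T₁.label-high ≤-refl)
        , S₁.step-adj hi-1<len A₁.at<len (inj₁ (sym (pred-step gap₁))) )
      where
      lo+1<len = <-trans gap₁ A₁.at<len
      hi-1<hi : pred A₁.at < A₁.at
      hi-1<hi = ≤-reflexive (pred-step gap₁)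
      hi-1<len = <-trans hi-1<hi A₁.at<len

    middle-ends₂ : Realised (inj₁ (Fin.suc Fin.zero)) (inj₂ (Fin.suc (Fin.suc Fin.zero)))
                 × Realised (inj₁ (Fin.suc Fin.zero)) (inj₂ (Fin.suc (Fin.suc (Fin.suc Fin.zero))))
    middle-ends₂ =
        ( S₂.vertexAt (suc D₂.at) , S₂.vertexAt D₂.at
        , trans (β-at₂ lo+1<len) (T₂.label-middle ≤-refl gap₂) , trans (β-at₂ D₂.at<len) (T₂.label-low ≤-refl)
        , Graph.sym G (S₂.step-adj D₂.at<len lo+1<len (inj₁ refl)) )
      , ( S₂.vertexAt (pred A₂.at) , S₂.vertexAt A₂.at
        , trans (β-at₂ hi-1<len) (T₂.label-middle (<⇒≤pred gap₂) hi-1<hi) , trans (β-at₂ A₂.at<len) (T₂.label-high ≤-refl)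
        , S₂.step-adj hi-1<len A₂.at<len (inj₁ (sym (pred-step gap₂))) )
      where
      lo+1<len = <-trans gap₂ A₂.at<len
      hi-1<hi : pred A₂.at < A₂.at
      hi-1<hi = ≤-reflexive (pred-step gap₂)
      hi-1<len = <-trans hi-1<hi A₂.at<len

    -- each edge of K_{2,4} between a degree-4 vertex i and a terminal j:
    -- along a path of L, or along a rung where Q₁ or Q₂ leaves or returns
    degree4-edge : ∀ i j → Realised (inj₁ i) (inj₂ j)
    degree4-edge Fin.zero Fin.zero = proj₁ middle-ends₁
    degree4-edge Fin.zero (Fin.suc Fin.zero) = proj₂ middle-ends₁
    degree4-edge Fin.zero (Fin.suc (Fin.suc Fin.zero)) =
      D₂.to , S₂.vertexAt D₂.at , middle-label₁ (outside₂ D₂.to∉P) D₂.to∈Q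
      , trans (β-at₂ D₂.at<len) (T₂.label-low ≤-refl) , Graph.sym G D₂.adj
    degree4-edge Fin.zero (Fin.suc (Fin.suc (Fin.suc Fin.zero))) =
      A₂.from , S₂.vertexAt A₂.at , middle-label₁ (outside₂ A₂.from∉P) A₂.from∈Q
      , trans (β-at₂ A₂.at<len) (T₂.label-high ≤-refl) , Graph.sym G A₂.adj
    degree4-edge (Fin.suc Fin.zero) Fin.zero =
      D₁.to , S₁.vertexAt D₁.at , middle-label₂ (outside₁ D₁.to∉P) D₁.to∈Q
      , trans (β-at₁ D₁.at<len) (T₁.label-low ≤-refl) , Graph.sym G D₁.adj
    degree4-edge (Fin.suc Fin.zero) (Fin.suc Fin.zero) =
      A₁.from , S₁.vertexAt A₁.at , middle-label₂ (outside₁ A₁.from∉P) A₁.from∈Q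
      , trans (β-at₁ A₁.at<len) (T₁.label-high ≤-refl) , Graph.sym G A₁.adj
    degree4-edge (Fin.suc Fin.zero) (Fin.suc (Fin.suc Fin.zero)) = proj₁ middle-ends₂
    degree4-edge (Fin.suc Fin.zero) (Fin.suc (Fin.suc (Fin.suc Fin.zero))) = proj₂ middle-ends₂

    edges : ∀ x y → K24Adj L x y → Realised x y
    edges (inj₁ i) (inj₂ j) _ = degree4-edge i j
    edges (inj₂ j) (inj₁ i) _ =
      let (u , v , βu , βv , uv) = degree4-edge i j in v , u , βv , βu , Graph.sym G uv

    path-edges-kept : ∀ u v → PathEdge L u v → β u ≢ β v → K24Adj L (β u) (β v)
    path-edges-kept u v (inj₁ e) differ =
      subst₂ (K24Adj L) (sym (β₁ u∈)) (sym (β₁ v∈))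
        (T₁.label-step gap₁ (S₁.edge-pos-step e) λ same → differ (trans (β₁ u∈) (trans same (sym (β₁ v∈)))))
      where u∈ = edge-start-∈ e
            v∈ = S₁.edge-end-∈ e
    path-edges-kept u v (inj₂ e) differ =
      subst₂ (K24Adj L) (sym (β₂ u∈)) (sym (β₂ v∈))
        (T₂.label-step gap₂ (S₂.edge-pos-step e) λ same → differ (trans (β₂ u∈) (trans same (sym (β₂ v∈)))))
      where u∈ = edge-start-∈ e
            v∈ = S₂.edge-end-∈ e

    model : XXModel L
    model = record
      { β = β
      ; nonempty = λ { (inj₁ i) → let (u , _ , βu , _) = degree4-edge i Fin.zero in u , βu
                     ; (inj₂ j) → terminal L j , terminal-label j }
      ; connected = class-walk
      ; edges = edges
      ; pathKept = path-edges-kept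
      ; termDeg2 = λ i → i , terminal-label i
      ; termInj = λ i j same → inj₂-injective (trans (sym (terminal-label i)) (trans same (terminal-label j)))
      }

  -- (⇐) If some other pair of disjoint paths Q₁, Q₂ joined the terminals,
  -- then neither stays inside its Pᵢ: a path staying inside would be Pᵢ
  -- itself, and the other path would meet it where it leaves its own Pⱼ
  -- (by spanning).  So both leave, and they yield an XX minor.
  unique-without-minor : ¬ HasXXMinor L → UniqueLinkage L
  unique-without-minor no-minor Q₁ Q₂ path₁ path₂ apartQ
    with All.all? (_∈? P₁ L) Q₁ | All.all? (_∈? P₂ L) Q₂
  ... | yes in₁ | yes in₂ = S₁.only-path-inside Q₁ path₁ in₁ , S₂.only-path-inside Q₂ path₂ in₂
  ... | yes in₁ | no out₂ =
    let open S₂.Departure (S₂.departure Q₂ path₂ out₂)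
    in ⊥-elim (apartQ to (subst (to ∈_) (sym (S₁.only-path-inside Q₁ path₁ in₁)) (outside₂ to∉P)) to∈Q)
  ... | no out₁ | yes in₂ =
    let open S₁.Departure (S₁.departure Q₁ path₁ out₁)
    in ⊥-elim (apartQ to to∈Q (subst (to ∈_) (sym (S₂.only-path-inside Q₂ path₂ in₂)) (outside₁ to∉P)))
  ... | no out₁ | no out₂ = ⊥-elim (no-minor (MinorFromDetours.model apartQ
                              (S₁.departure Q₁ path₁ out₁) (S₁.arrival Q₁ path₁ out₁)
                              (S₂.departure Q₂ path₂ out₂) (S₂.arrival Q₂ path₂ out₂)))

  record CrossingRungs : Set where
    field
      p₁ p₂ p₃ p₄ q₁ q₂ q₃ q₄ : ℕ
      p₂< : p₂ < S₁.len
      p₃< : p₃ < S₁.len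
      p₄< : p₄ < S₁.len
      q₁< : q₁ < S₂.len
      q₂< : q₂ < S₂.len
      q₄< : q₄ < S₂.len
      p₁<p₃ : p₁ < p₃
      p₁<p₄ : p₁ < p₄
      p₃<p₂ : p₃ < p₂
      p₄<p₂ : p₄ < p₂
      q₃<q₁ : q₃ < q₁
      q₃<q₂ : q₃ < q₂
      q₁<q₄ : q₁ < q₄
      q₂<q₄ : q₂ < q₄
      rung₁ : Adj G (S₁.vertexAt p₁) (S₂.vertexAt q₁)
      rung₂ : Adj G (S₂.vertexAt q₂) (S₁.vertexAt p₂)
      rung₃ : Adj G (S₂.vertexAt q₃) (S₁.vertexAt p₃)
      rung₄ : Adj G (S₁.vertexAt p₄) (S₂.vertexAt q₄)

  -- Crossing rungs allow rerouting: R₁ = P₁[0..p₁] P₂[q₁..q₂] P₁[p₂..end]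
  -- and R₂ = P₂[0..q₃] P₁[p₃..p₄] P₂[q₄..end] are disjoint paths joining
  -- the same terminals as L, and R₁ ≠ P₁.
  not-unique-with-crossing-rungs : CrossingRungs → ¬ UniqueLinkage L
  not-unique-with-crossing-rungs c unique =
    apart (subst (S₂.vertexAt q₁ ∈_) R₁≡P₁ rung-end∈R₁) (S₂.vertexAt-∈ q₁<)
    where
    open CrossingRungs c
    p₁< = <-trans p₁<p₃ p₃<
    q₃< = <-trans q₃<q₁ q₁<
    p₁<p₂ = <-trans p₁<p₃ p₃<p₂
    q₃<q₄ = <-trans q₃<q₁ q₁<q₄

    A  = S₁.subpath 0 p₁
    M₁ = S₂.subpath q₁ q₂
    B  = S₁.subpath p₂ S₁.end
    C  = S₂.subpath 0 q₃
    M₂ = S₁.subpath p₃ p₄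
    D  = S₂.subpath q₄ S₂.end
    R₁ = A ++ M₁ ++ B
    R₂ = C ++ M₂ ++ D

    M₁-∈ : ∀ {z} → z ∈ M₁ → z ∈ P₂ L × q₃ < S₂.pos z × S₂.pos z < q₄
    M₁-∈ z∈ = let (z∈P , between) = S₂.subpath-∈ q₁< q₂< z∈
              in z∈P , between-≥ q₃<q₁ q₃<q₂ between , between-< q₁<q₄ q₂<q₄ between

    M₂-∈ : ∀ {z} → z ∈ M₂ → z ∈ P₁ L × p₁ < S₁.pos z × S₁.pos z < p₂
    M₂-∈ z∈ = let (z∈P , between) = S₁.subpath-∈ p₃< p₄< z∈
              in z∈P , between-≥ p₁<p₃ p₁<p₄ between , between-< p₃<p₂ p₄<p₂ between

    R₁-∈ : ∀ {z} → z ∈ R₁ → (z ∈ P₁ L × (S₁.pos z ≤ p₁ ⊎ p₂ ≤ S₁.pos z))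
                          ⊎ (z ∈ P₂ L × q₃ < S₂.pos z × S₂.pos z < q₄)
    R₁-∈ z∈ with ∈-++⁻ A z∈
    ... | inj₁ z∈A = let (z∈P , ≤p₁) = S₁.initial-∈ p₁< z∈A in inj₁ (z∈P , inj₁ ≤p₁)
    ... | inj₂ z∈MB with ∈-++⁻ M₁ z∈MB
    ...   | inj₁ z∈M = inj₂ (M₁-∈ z∈M)
    ...   | inj₂ z∈B = let (z∈P , p₂≤) = S₁.final-∈ p₂< z∈B in inj₁ (z∈P , inj₂ p₂≤)

    R₂-∈ : ∀ {z} → z ∈ R₂ → (z ∈ P₂ L × (S₂.pos z ≤ q₃ ⊎ q₄ ≤ S₂.pos z))
                          ⊎ (z ∈ P₁ L × p₁ < S₁.pos z × S₁.pos z < p₂)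
    R₂-∈ z∈ with ∈-++⁻ C z∈
    ... | inj₁ z∈C = let (z∈P , ≤q₃) = S₂.initial-∈ q₃< z∈C in inj₁ (z∈P , inj₁ ≤q₃)
    ... | inj₂ z∈MD with ∈-++⁻ M₂ z∈MD
    ...   | inj₁ z∈M = inj₂ (M₂-∈ z∈M)
    ...   | inj₂ z∈D = let (z∈P , q₄≤) = S₂.final-∈ q₄< z∈D in inj₁ (z∈P , inj₂ q₄≤)

    apart-R : Disjoint R₁ R₂
    apart-R z z∈R₁ z∈R₂ with R₁-∈ z∈R₁ | R₂-∈ z∈R₂
    ... | inj₁ (z∈P₁ , _) | inj₁ (z∈P₂ , _) = apart z∈P₁ z∈P₂
    ... | inj₂ (z∈P₂ , _) | inj₂ (z∈P₁ , _) = apart z∈P₁ z∈P₂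
    ... | inj₁ (_ , inj₁ ≤p₁) | inj₂ (_ , p₁< , _) = <⇒≱ p₁< ≤p₁
    ... | inj₁ (_ , inj₂ p₂≤) | inj₂ (_ , _ , <p₂) = <⇒≱ <p₂ p₂≤
    ... | inj₂ (_ , q₃< , _) | inj₁ (_ , inj₁ ≤q₃) = <⇒≱ q₃< ≤q₃
    ... | inj₂ (_ , _ , <q₄) | inj₁ (_ , inj₂ q₄≤) = <⇒≱ <q₄ q₄≤

    path₁ : IsPath G (s₁ L) (t₁ L) R₁
    path₁ = join-paths {G = G} (S₁.initial-path p₁<)
              (join-paths {G = G} (S₂.subpath-isPath q₁< q₂<) (S₁.final-path p₂<) rung₂
                 (λ z z∈M z∈B → apart (proj₁ (S₁.final-∈ p₂< z∈B)) (proj₁ (M₁-∈ z∈M))))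
              rung₁ apart-A
      where
      apart-A : Disjoint A (M₁ ++ B)
      apart-A z z∈A z∈MB with S₁.initial-∈ p₁< z∈A | ∈-++⁻ M₁ z∈MB
      ... | z∈P , _ | inj₁ z∈M = apart z∈P (proj₁ (M₁-∈ z∈M))
      ... | _ , ≤p₁ | inj₂ z∈B = <⇒≱ p₁<p₂ (≤-trans (proj₂ (S₁.final-∈ p₂< z∈B)) ≤p₁)

    path₂ : IsPath G (s₂ L) (t₂ L) R₂
    path₂ = join-paths {G = G} (S₂.initial-path q₃<)
              (join-paths {G = G} (S₁.subpath-isPath p₃< p₄<) (S₂.final-path q₄<) rung₄
                 (λ z z∈M z∈D → apart (proj₁ (M₂-∈ z∈M)) (proj₁ (S₂.final-∈ q₄< z∈D))))
              rung₃ apart-C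
      where
      apart-C : Disjoint C (M₂ ++ D)
      apart-C z z∈C z∈MD with S₂.initial-∈ q₃< z∈C | ∈-++⁻ M₂ z∈MD
      ... | z∈P , _ | inj₁ z∈M = apart (proj₁ (M₂-∈ z∈M)) z∈P
      ... | _ , ≤q₃ | inj₂ z∈D = <⇒≱ q₃<q₄ (≤-trans (proj₂ (S₂.final-∈ q₄< z∈D)) ≤q₃)

    R₁≡P₁ : R₁ ≡ P₁ L
    R₁≡P₁ = proj₁ (unique R₁ R₂ path₁ path₂ apart-R)

    rung-end∈R₁ : S₂.vertexAt q₁ ∈ R₁
    rung-end∈R₁ = ∈-++⁺ʳ A (∈-++⁺ˡ (head-∈ M₁ (S₂.subpath-head q₁ q₂)))


  -- (⇒) An XX minor yields crossing rungs.  Its branch sets are connected by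
  -- path edges, so each lies inside one path of L and is an interval there.
  -- Leaving the branch set of s₁ along P₁ one enters a degree-4 branch set
  -- X ⊆ P₁, and likewise a degree-4 branch set Y ⊆ P₂.  The K_{2,4}-edges
  -- s₁Y, t₁Y, s₂X, t₂X are realised by rungs, and the interval structure
  -- puts their ends in crossing order.
  module CrossingFromMinor (M : XXModel L) where
    open XXModel M

    module C₁ = S₁.ConnectedClasses stay₁ β connected
    module C₂ = S₂.ConnectedClasses stay₂ β connected

    degree4≢terminal : ∀ k {w i} → β w ≡ inj₁ i → β w ≢ β (terminal L k)
    degree4≢terminal k βw same with termDeg2 k
    ... | j , βk with trans (sym βw) (trans same βk)
    ... | ()

    terminal-meets-degree4 : ∀ k {w i} → β w ≡ inj₁ i → K24Adj L (β (terminal L k)) (β w)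
    terminal-meets-degree4 k βw with termDeg2 k
    ... | j , βk = subst₂ (K24Adj L) (sym βk) (sym βw) tt

    leaves-terminal : ∀ k {u v} → PathEdge L u v → β u ≡ β (terminal L k) → β v ≢ β u →
                      ∃[ i ] β v ≡ inj₁ i
    leaves-terminal k {u} {v} pe βu differ with termDeg2 k
    ... | j , βk = neighbour (trans βu βk) (pathKept u v pe (differ ∘ sym))
      where
      neighbour : ∀ {x y} → x ≡ inj₂ j → K24Adj L x y → ∃[ i ] y ≡ inj₁ i
      neighbour {y = inj₁ i} _ _ = i , refl
      neighbour {y = inj₂ _} refl ()

    X : ∃[ i ] ∃[ x ] (x ∈ P₁ L × β x ≡ inj₁ i)
    X with C₁.leaves-initial-class (≡-dec Fin._≟_ Fin._≟_) t₁≢s₁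
      where t₁≢s₁ : β (t₁ L) ≢ β (s₁ L)
            t₁≢s₁ same with termInj (Fin.suc Fin.zero) Fin.zero same
            ... | ()
    ... | h , h+1< , in-class , next-out =
      let (i , βx) = leaves-terminal Fin.zero (inj₁ (S₁.positions-edge (<-trans (n<1+n h) h+1<) h+1< (inj₁ refl)))
                                     in-class (λ same → next-out (trans same in-class))
      in i , S₁.vertexAt (suc h) , S₁.vertexAt-∈ h+1< , βx

    Y : ∃[ i ] ∃[ y ] (y ∈ P₂ L × β y ≡ inj₁ i)
    Y with C₂.leaves-initial-class (≡-dec Fin._≟_ Fin._≟_) t₂≢s₂
      where t₂≢s₂ : β (t₂ L) ≢ β (s₂ L)
            t₂≢s₂ same with termInj (Fin.suc (Fin.suc (Fin.suc Fin.zero))) (Fin.suc (Fin.suc Fin.zero)) same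
            ... | ()
    ... | h , h+1< , in-class , next-out =
      let (i , βy) = leaves-terminal (Fin.suc (Fin.suc Fin.zero))
                                     (inj₂ (S₂.positions-edge (<-trans (n<1+n h) h+1<) h+1< (inj₁ refl)))
                                     in-class (λ same → next-out (trans same in-class))
      in i , S₂.vertexAt (suc h) , S₂.vertexAt-∈ h+1< , βy

    record Rung (PA PB : List (Fin n)) (a b : Fin n) : Set where
      field
        u v : Fin n
        u∈  : u ∈ PA
        v∈  : v ∈ PB
        βu  : β u ≡ β a
        βv  : β v ≡ β b
        adj : Adj G u v

    rung : ∀ {PA PB a b} → K24Adj L (β a) (β b) →
           (∀ {w} → β a ≡ β w → w ∈ PA) → (∀ {w} → β b ≡ β w → w ∈ PB) → Rung PA PB a b
    rung adj-ab inA inB =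
      let (u , v , βu , βv , uv) = edges _ _ adj-ab
      in record { u = u ; v = v ; u∈ = inA (sym βu) ; v∈ = inB (sym βv) ; βu = βu ; βv = βv ; adj = uv }

    crossing : CrossingRungs
    crossing = record
      { p₁ = S₁.pos (u r₁) ; q₁ = S₂.pos (v r₁)
      ; p₂ = S₁.pos (u r₂) ; q₂ = S₂.pos (v r₂)
      ; q₃ = S₂.pos (u r₃) ; p₃ = S₁.pos (v r₃)
      ; q₄ = S₂.pos (u r₄) ; p₄ = S₁.pos (v r₄)
      ; p₂< = S₁.pos-< (u∈ r₂) ; p₃< = S₁.pos-< (v∈ r₃) ; p₄< = S₁.pos-< (v∈ r₄)
      ; q₁< = S₂.pos-< (v∈ r₁) ; q₂< = S₂.pos-< (v∈ r₂) ; q₄< = S₂.pos-< (u∈ r₄)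
      ; p₁<p₃ = C₁.initial-class (S₁.pos-< (u∈ r₁)) (S₁.pos-< (v∈ r₃)) (on₁ (u∈ r₁) (βu r₁)) (in-X r₃ Fin.zero)
      ; p₁<p₄ = C₁.initial-class (S₁.pos-< (u∈ r₁)) (S₁.pos-< (v∈ r₄)) (on₁ (u∈ r₁) (βu r₁)) (in-X r₄ Fin.zero)
      ; p₃<p₂ = C₁.final-class (S₁.pos-< (u∈ r₂)) (S₁.pos-< (v∈ r₃)) (on₁ (u∈ r₂) (βu r₂)) (in-X r₃ (Fin.suc Fin.zero))
      ; p₄<p₂ = C₁.final-class (S₁.pos-< (u∈ r₂)) (S₁.pos-< (v∈ r₄)) (on₁ (u∈ r₂) (βu r₂)) (in-X r₄ (Fin.suc Fin.zero))
      ; q₃<q₁ = C₂.initial-class (S₂.pos-< (u∈ r₃)) (S₂.pos-< (v∈ r₁)) (on₂ (u∈ r₃) (βu r₃)) (in-Y r₁ (Fin.suc (Fin.suc Fin.zero)))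
      ; q₃<q₂ = C₂.initial-class (S₂.pos-< (u∈ r₃)) (S₂.pos-< (v∈ r₂)) (on₂ (u∈ r₃) (βu r₃)) (in-Y r₂ (Fin.suc (Fin.suc Fin.zero)))
      ; q₁<q₄ = C₂.final-class (S₂.pos-< (u∈ r₄)) (S₂.pos-< (v∈ r₁)) (on₂ (u∈ r₄) (βu r₄)) (in-Y r₁ (Fin.suc (Fin.suc (Fin.suc Fin.zero))))
      ; q₂<q₄ = C₂.final-class (S₂.pos-< (u∈ r₄)) (S₂.pos-< (v∈ r₂)) (on₂ (u∈ r₄) (βu r₄)) (in-Y r₂ (Fin.suc (Fin.suc (Fin.suc Fin.zero))))
      ; rung₁ = at-positions (adj r₁) (S₁.vertexAt-pos (u∈ r₁)) (S₂.vertexAt-pos (v∈ r₁))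
      ; rung₂ = at-positions (Graph.sym G (adj r₂)) (S₂.vertexAt-pos (v∈ r₂)) (S₁.vertexAt-pos (u∈ r₂))
      ; rung₃ = at-positions (adj r₃) (S₂.vertexAt-pos (u∈ r₃)) (S₁.vertexAt-pos (v∈ r₃))
      ; rung₄ = at-positions (Graph.sym G (adj r₄)) (S₁.vertexAt-pos (v∈ r₄)) (S₂.vertexAt-pos (u∈ r₄))
      }
      where
      open Rung
      x  = proj₁ (proj₂ X)
      βx = proj₂ (proj₂ (proj₂ X))
      y  = proj₁ (proj₂ Y)
      βy = proj₂ (proj₂ (proj₂ Y))

      r₁ : Rung (P₁ L) (P₂ L) (s₁ L) y
      r₁ = rung (terminal-meets-degree4 Fin.zero βy) (λ same → C₁.class-inside same S₁.s∈)
                (λ same → C₂.class-inside same (proj₁ (proj₂ (proj₂ Y))))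
      r₂ : Rung (P₁ L) (P₂ L) (t₁ L) y
      r₂ = rung (terminal-meets-degree4 (Fin.suc Fin.zero) βy) (λ same → C₁.class-inside same S₁.t∈)
                (λ same → C₂.class-inside same (proj₁ (proj₂ (proj₂ Y))))
      r₃ : Rung (P₂ L) (P₁ L) (s₂ L) x
      r₃ = rung (terminal-meets-degree4 (Fin.suc (Fin.suc Fin.zero)) βx) (λ same → C₂.class-inside same S₂.s∈)
                (λ same → C₁.class-inside same (proj₁ (proj₂ (proj₂ X))))
      r₄ : Rung (P₂ L) (P₁ L) (t₂ L) x
      r₄ = rung (terminal-meets-degree4 (Fin.suc (Fin.suc (Fin.suc Fin.zero))) βx) (λ same → C₂.class-inside same S₂.t∈)
                (λ same → C₁.class-inside same (proj₁ (proj₂ (proj₂ X))))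

      on₁ : ∀ {w a} → w ∈ P₁ L → β w ≡ a → β (S₁.vertexAt (S₁.pos w)) ≡ a
      on₁ w∈ βw = trans (cong β (S₁.vertexAt-pos w∈)) βw
      on₂ : ∀ {w a} → w ∈ P₂ L → β w ≡ a → β (S₂.vertexAt (S₂.pos w)) ≡ a
      on₂ w∈ βw = trans (cong β (S₂.vertexAt-pos w∈)) βw

      in-X : ∀ {PA a} (r : Rung PA (P₁ L) a x) k → β (S₁.vertexAt (S₁.pos (v r))) ≢ β (terminal L k)
      in-X r k = degree4≢terminal k (on₁ (v∈ r) (trans (βv r) βx))
      in-Y : ∀ {PA a} (r : Rung PA (P₂ L) a y) k → β (S₂.vertexAt (S₂.pos (v r))) ≢ β (terminal L k)
      in-Y r k = degree4≢terminal k (on₂ (v∈ r) (trans (βv r) βy))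

      at-positions : ∀ {a b a′ b′} → Adj G a b → a′ ≡ a → b′ ≡ b → Adj G a′ b′
      at-positions ab refl refl = ab

  no-minor-if-vital : Vital L → ¬ HasXXMinor L
  no-minor-if-vital (unique , _) M = not-unique-with-crossing-rungs (CrossingFromMinor.crossing M) unique

lemma2p2 : (n : ℕ) (G : Graph n) (L : Linkage2 G) →
           Spanning L → Chordless L →
           Vital L ⇔ (¬ HasXXMinor L)
lemma2p2 n G L spanning chordless =
  mk⇔ no-minor-if-vital (λ no-minor → unique-without-minor no-minor , spanning)
  where open ChordlessLinkage L spanning chordless
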